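{- Let $m,n,d$ be positive integers and let $x\in(0,1]$ with $xn$ an integer. After all $m$ balls have been placed by $\mathrm{GREEDY}(m,n,d)$, the expected total number of balls in the $xn$ least-loaded bins is at most $x^d m$. Moreover, for every integer $k\ge 1$, the probability that the $xn$ least-loaded bins together contain at least $k$ balls is at most $$1-\sum_{i=0}^{k-1}\binom{m}{i}(1-x)^{m-i}x^{i}.$$
   Context: $\mathrm{GREEDY}(m,n,d)$ places $m$ balls into $n$ bins $B_1,\dots,B_n$ over time steps $t=1,\dots,m$. At each time step, $d$ indices are selected from $[n]=\{1,\dots,n\}$ independently and uniformly at random with replacement, forming a multiset $S_t$; the $t$-th ball is placed into a bin $B_M$ with $M\in S_t$ whose current load is maximal among the bins indexed by $S_t$; ties among maximal bins are broken uniformly at random. The load of a bin is the number of balls in it. "The number of balls in the $xn$ least-loaded bins" means the sum of the $xn$ smallest loads. -}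

module Defs where

open import Data.Nat as ℕ using (ℕ; zero; suc; _⊔_; _∸_)
open import Data.Nat.Properties using (≤-decTotalOrder)
open import Data.Nat.Combinatorics using (_C_)
open import Data.Integer as ℤ using (+_)
open import Data.Rational as ℚ using (ℚ; 0ℚ; 1ℚ; _+_; _*_; _-_)
open import Data.Fin as Fin using (Fin)
open import Data.Fin.Properties using () renaming (_≟_ to _≟ᶠ_)
open import Data.Vec as Vec using (Vec)
open import Data.List as List using (List; []; _∷_; length; filter; allFin; take; concatMap; replicate)
import Data.List.Membership.DecPropositional as MemDec
open import Data.List.Sort (≤-decTotalOrder) using (sort)
open import Data.Product using (_×_; _,_)
open import Relation.Nullary using (Dec; _×-dec_)
open import Relation.Unary using (Pred)
open import Level using (0ℓ)
open import Data.Nat.ListAction using (sum)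
open import Data.Nat using () renaming (_≟_ to _≟ℕ_)

-- Finite probability distributions: lists of (probability, outcome).

Dist : Set → Set
Dist A = List (ℚ × A)

return : {A : Set} → A → Dist A
return a = (1ℚ , a) ∷ []

_>>=_ : {A B : Set} → Dist A → (A → Dist B) → Dist B
μ >>= f = concatMap (λ { (p , a) → List.map (λ { (q , b) → (p * q , b) }) (f a) }) μ

-- uniform distribution on the entries of a list (with multiplicity)
uniform : {A : Set} → List A → Dist A
uniform []         = []
uniform (a ∷ as)   = List.map (λ b → ((+ 1) ℚ./ suc (length as) , b)) (a ∷ as)

𝔼 : {A : Set} → Dist A → (A → ℚ) → ℚ
𝔼 μ f = List.foldr (λ { (p , a) acc → p * f a + acc }) 0ℚ μ

ℙ : {A : Set} → Dist A → {P : Pred A 0ℓ} → ((a : A) → Dec (P a)) → ℚ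
ℙ μ P? = List.foldr (λ { (p , a) acc → (if Relation.Nullary.Dec.does (P? a) then p else 0ℚ) + acc }) 0ℚ μ
  where open import Data.Bool using (if_then_else_)

Loads : ℕ → Set
Loads n = Vec ℕ n

-- all ordered d-tuples of indices in [n] (n^d of them): sampling with replacement
tuples : (n d : ℕ) → List (List (Fin n))
tuples n zero    = [] ∷ []
tuples n (suc d) = concatMap (λ i → List.map (i ∷_) (tuples n d)) (allFin n)

maxLoad : {n : ℕ} → Loads n → List (Fin n) → ℕ
maxLoad L S = List.foldr (λ i acc → Vec.lookup L i ⊔ acc) 0 S

maximalBins : {n : ℕ} → Loads n → List (Fin n) → List (Fin n)
maximalBins {n} L S = filter (λ i → (MemDec._∈?_ (_≟ᶠ_ {n}) i S) ×-dec (Vec.lookup L i ≟ℕ maxLoad L S)) (allFin n)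

addBall : {n : ℕ} → Loads n → Fin n → Loads n
addBall L i = Vec.updateAt L i suc

step : (n d : ℕ) → Loads n → Dist (Loads n)
step n d L =
  uniform (tuples n d) >>= λ S →
  uniform (maximalBins L S) >>= λ i →
  return (addBall L i)

greedy : (t n d : ℕ) → Dist (Loads n)
greedy zero    n d = return (Vec.replicate n 0)
greedy (suc t) n d = greedy t n d >>= step n d

leastLoadedSum : {n : ℕ} → ℕ → Loads n → ℕ
leastLoadedSum j L = sum (take j (sort (Vec.toList L)))

_^ℚ_ : ℚ → ℕ → ℚ
q ^ℚ zero  = 1ℚ
q ^ℚ suc k = q * (q ^ℚ k)

Σ< : ℕ → (ℕ → ℚ) → ℚ
Σ< zero    f = 0ℚ
Σ< (suc k) f = Σ< k f + f k

ℕ→ℚ : ℕ → ℚ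
ℕ→ℚ k = (+ k) ℚ./ 1

binomialTailBound : (m k : ℕ) → ℚ → ℚ
binomialTailBound m k x =
  1ℚ - Σ< k (λ i → ℕ→ℚ (m C i) * ((1ℚ - x) ^ℚ (m ∸ i)) * (x ^ℚ i))

module Submission where

-- Let s be the number of balls in the j least-loaded bins and call a bin light if at most j bins have load
-- at most its own. A ball raises s by at most one, and only when it lands in a light bin; since GREEDY
-- puts it into a bin of maximal load among the d sampled ones, all d samples must then be light. At most
-- j bins are light, so this has probability at most (j/n)^d = x^d ≤ x. Hence E[s] grows by at most x^d
-- per ball, and P(s ≥ k+1) after t+1 balls is at most (1-x)·P(s ≥ k+1) + x·P(s ≥ k) after t balls,
-- the Pascal recursion of the binomial tail 1 - P(Bin(t, x) < k).

module Rationals where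

  open import Defs
  open import Data.Nat as ℕ using (ℕ; zero; suc; _^_)
  import Data.Integer as ℤ
  import Data.Integer.Properties as ℤ
  open import Data.Integer.Solver renaming (module +-*-Solver to ℤ-Solver)
  open import Data.Rational as ℚ using (ℚ; 0ℚ; 1ℚ; _+_; _*_; _-_; _/_; _≤_; toℚᵘ)
  open import Data.Rational.Properties
  open import Data.Rational.Solver using (module +-*-Solver)
  import Data.Rational.Unnormalised as ℚᵘ
  import Data.Rational.Unnormalised.Properties as ℚᵘ
  open import Relation.Binary.PropositionalEquality

  toℚᵘ-ℕ→ℚ : ∀ a → toℚᵘ (ℕ→ℚ a) ℚᵘ.≃ ℚᵘ.mkℚᵘ (ℤ.+ a) 0
  toℚᵘ-ℕ→ℚ a = toℚᵘ-fromℚᵘ (ℚᵘ.mkℚᵘ (ℤ.+ a) 0)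

  ℕ→ℚ-+ : ∀ a b → ℕ→ℚ (a ℕ.+ b) ≡ ℕ→ℚ a + ℕ→ℚ b
  ℕ→ℚ-+ a b = toℚᵘ-injective (begin
    toℚᵘ (ℕ→ℚ (a ℕ.+ b))                       ≈⟨ toℚᵘ-ℕ→ℚ (a ℕ.+ b) ⟩
    ℚᵘ.mkℚᵘ (ℤ.+ (a ℕ.+ b)) 0                  ≈⟨ ℚᵘ.*≡* (solve 2 (λ x y → (x :+ y) :* ı := (x :* ı :+ y :* ı) :* ı) refl (ℤ.+ a) (ℤ.+ b)) ⟩
    ℚᵘ.mkℚᵘ (ℤ.+ a) 0 ℚᵘ.+ ℚᵘ.mkℚᵘ (ℤ.+ b) 0    ≈⟨ ℚᵘ.+-cong (toℚᵘ-ℕ→ℚ a) (toℚᵘ-ℕ→ℚ b) ⟨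
    toℚᵘ (ℕ→ℚ a) ℚᵘ.+ toℚᵘ (ℕ→ℚ b)             ≈⟨ toℚᵘ-homo-+ (ℕ→ℚ a) (ℕ→ℚ b) ⟨
    toℚᵘ (ℕ→ℚ a + ℕ→ℚ b)                       ∎)
    where open ℚᵘ.≃-Reasoning
          open ℤ-Solver
          ı = con (ℤ.+ 1)

  ℕ→ℚ-* : ∀ a b → ℕ→ℚ (a ℕ.* b) ≡ ℕ→ℚ a * ℕ→ℚ b
  ℕ→ℚ-* a b = toℚᵘ-injective (begin
    toℚᵘ (ℕ→ℚ (a ℕ.* b))                       ≈⟨ toℚᵘ-ℕ→ℚ (a ℕ.* b) ⟩
    ℚᵘ.mkℚᵘ (ℤ.+ (a ℕ.* b)) 0                  ≈⟨ ℚᵘ.*≡* (trans (cong (ℤ._* (ℤ.+ 1 ℤ.* ℤ.+ 1)) (ℤ.pos-* a b))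
                                                     (solve 2 (λ x y → (x :* y) :* (ı :* ı) := (x :* y) :* ı) refl (ℤ.+ a) (ℤ.+ b))) ⟩
    ℚᵘ.mkℚᵘ (ℤ.+ a) 0 ℚᵘ.* ℚᵘ.mkℚᵘ (ℤ.+ b) 0    ≈⟨ ℚᵘ.*-cong (toℚᵘ-ℕ→ℚ a) (toℚᵘ-ℕ→ℚ b) ⟨
    toℚᵘ (ℕ→ℚ a) ℚᵘ.* toℚᵘ (ℕ→ℚ b)             ≈⟨ toℚᵘ-homo-* (ℕ→ℚ a) (ℕ→ℚ b) ⟨
    toℚᵘ (ℕ→ℚ a * ℕ→ℚ b)                       ∎)
    where open ℚᵘ.≃-Reasoning
          open ℤ-Solver
          ı = con (ℤ.+ 1)

  ℕ→ℚ-mono-≤ : ∀ {a b} → a ℕ.≤ b → ℕ→ℚ a ≤ ℕ→ℚ b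
  ℕ→ℚ-mono-≤ {a} {b} a≤b = toℚᵘ-cancel-≤ (begin
    toℚᵘ (ℕ→ℚ a)         ≃⟨ toℚᵘ-ℕ→ℚ a ⟩
    ℚᵘ.mkℚᵘ (ℤ.+ a) 0    ≤⟨ ℚᵘ.*≤* (ℤ.*-monoʳ-≤-nonNeg (ℤ.+ 1) (ℤ.+≤+ a≤b)) ⟩
    ℚᵘ.mkℚᵘ (ℤ.+ b) 0    ≃⟨ toℚᵘ-ℕ→ℚ b ⟨
    toℚᵘ (ℕ→ℚ b)         ∎)
    where open ℚᵘ.≤-Reasoning

  a/n*n≡a : ∀ a n .{{_ : ℕ.NonZero n}} → ((ℤ.+ a) / n) * ℕ→ℚ n ≡ ℕ→ℚ a
  a/n*n≡a a n@(suc k) = toℚᵘ-injective (begin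
    toℚᵘ ((ℤ.+ a) / n * ℕ→ℚ n)                 ≈⟨ toℚᵘ-homo-* ((ℤ.+ a) / n) (ℕ→ℚ n) ⟩
    toℚᵘ ((ℤ.+ a) / n) ℚᵘ.* toℚᵘ (ℕ→ℚ n)       ≈⟨ ℚᵘ.*-cong (toℚᵘ-fromℚᵘ (ℚᵘ.mkℚᵘ (ℤ.+ a) k)) (toℚᵘ-ℕ→ℚ n) ⟩
    ℚᵘ.mkℚᵘ (ℤ.+ a) k ℚᵘ.* ℚᵘ.mkℚᵘ (ℤ.+ n) 0    ≈⟨ ℚᵘ.*≡* (solve 2 (λ x y → (x :* y) :* ı := x :* (y :* ı)) refl (ℤ.+ a) (ℤ.+ n)) ⟩
    ℚᵘ.mkℚᵘ (ℤ.+ a) 0                          ≈⟨ toℚᵘ-ℕ→ℚ a ⟨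
    toℚᵘ (ℕ→ℚ a)                               ∎)
    where open ℚᵘ.≃-Reasoning
          open ℤ-Solver
          ı = con (ℤ.+ 1)

  0≤a/n : ∀ a n .{{_ : ℕ.NonZero n}} → 0ℚ ≤ (ℤ.+ a) / n
  0≤a/n a n = nonNegative⁻¹ _ {{normalize-nonNeg a n}}

  0≤1 : 0ℚ ≤ 1ℚ
  0≤1 = nonNegative⁻¹ 1ℚ

  *-preserves-0≤ : ∀ {p q} → 0ℚ ≤ p → 0ℚ ≤ q → 0ℚ ≤ p * q
  *-preserves-0≤ {p} {q} 0≤p 0≤q = nonNegative⁻¹ _ {{nonNeg*nonNeg⇒nonNeg p {{ℚ.nonNegative 0≤p}} q {{ℚ.nonNegative 0≤q}}}}

  ^ℚ-nonNeg : ∀ {x} → 0ℚ ≤ x → ∀ k → 0ℚ ≤ x ^ℚ k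
  ^ℚ-nonNeg 0≤x zero    = 0≤1
  ^ℚ-nonNeg 0≤x (suc k) = *-preserves-0≤ 0≤x (^ℚ-nonNeg 0≤x k)

  ^ℚ≤1 : ∀ {x} → 0ℚ ≤ x → x ≤ 1ℚ → ∀ k → x ^ℚ k ≤ 1ℚ
  ^ℚ≤1 0≤x x≤1 zero    = ≤-refl
  ^ℚ≤1 {x} 0≤x x≤1 (suc k) = ≤-trans (*-monoˡ-≤-nonNeg x {{ℚ.nonNegative 0≤x}} (^ℚ≤1 0≤x x≤1 k)) (≤-trans (≤-reflexive (*-identityʳ x)) x≤1)

  ^ℚ≤base : ∀ {x} → 0ℚ ≤ x → x ≤ 1ℚ → ∀ {k} → 1 ℕ.≤ k → x ^ℚ k ≤ x
  ^ℚ≤base {x} 0≤x x≤1 {suc k} _ = ≤-trans (*-monoˡ-≤-nonNeg x {{ℚ.nonNegative 0≤x}} (^ℚ≤1 0≤x x≤1 k)) (≤-reflexive (*-identityʳ x))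

  p≤q⇒0≤q-p : ∀ {p q} → p ≤ q → 0ℚ ≤ q - p
  p≤q⇒0≤q-p {p} p≤q = ≤-trans (≤-reflexive (sym (+-inverseʳ p))) (+-monoˡ-≤ (ℚ.- p) p≤q)

  [a/n]^k*n^k≡a^k : ∀ a n .{{_ : ℕ.NonZero n}} k → ((ℤ.+ a) / n) ^ℚ k * ℕ→ℚ (n ^ k) ≡ ℕ→ℚ (a ^ k)
  [a/n]^k*n^k≡a^k a n zero    = refl
  [a/n]^k*n^k≡a^k a n (suc k) = begin
    x * x ^ℚ k * ℕ→ℚ (n ℕ.* n ^ k)           ≡⟨ cong (x * x ^ℚ k *_) (ℕ→ℚ-* n (n ^ k)) ⟩
    x * x ^ℚ k * (ℕ→ℚ n * ℕ→ℚ (n ^ k))       ≡⟨ solve 4 (λ x X N M → x :* X :* (N :* M) := (x :* N) :* (X :* M)) refl x (x ^ℚ k) (ℕ→ℚ n) (ℕ→ℚ (n ^ k)) ⟩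
    (x * ℕ→ℚ n) * (x ^ℚ k * ℕ→ℚ (n ^ k))     ≡⟨ cong₂ _*_ (a/n*n≡a a n) ([a/n]^k*n^k≡a^k a n k) ⟩
    ℕ→ℚ a * ℕ→ℚ (a ^ k)                      ≡⟨ sym (ℕ→ℚ-* a (a ^ k)) ⟩
    ℕ→ℚ (a ^ suc k)                          ∎
    where open ≡-Reasoning
          open +-*-Solver
          x = (ℤ.+ a) / n

module Distributions where

  open import Defs
  open Rationals
  open import Function using (_∘_)
  open import Data.Nat using (suc)
  import Data.Integer as ℤ
  open import Data.Unit using (⊤; tt)
  open import Data.Bool using (true; false; if_then_else_)
  open import Data.Rational as ℚ using (ℚ; 0ℚ; 1ℚ; _+_; _*_; _/_; _≤_)
  open import Data.Rational.Properties
  open import Data.Rational.Solver using (module +-*-Solver)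
  open import Data.List as List using (List; []; _∷_; _++_; length; filter)
  open import Data.List.Properties using (filter-all)
  open import Data.List.Relation.Unary.All as All using (All; []; _∷_)
  import Data.List.Relation.Unary.All.Properties as All
  open import Data.Product using (_×_; _,_; proj₁; proj₂)
  open import Relation.Nullary using (Dec; yes; no; does; ¬_)
  open import Relation.Nullary.Decidable using (dec-true; dec-false)
  open import Relation.Unary using (Pred; Decidable)
  open import Relation.Binary.PropositionalEquality
  open import Level using (0ℓ)

  𝟙 : {P : Set} → Dec P → ℚ
  𝟙 P? = if does P? then 1ℚ else 0ℚ

  𝟙-nonNeg : ∀ {P : Set} (P? : Dec P) → 0ℚ ≤ 𝟙 P?
  𝟙-nonNeg (yes _) = 0≤1
  𝟙-nonNeg (no  _) = ≤-refl

  𝟙≤1 : ∀ {P : Set} (P? : Dec P) → 𝟙 P? ≤ 1ℚ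
  𝟙≤1 (yes _) = ≤-refl
  𝟙≤1 (no  _) = 0≤1

  𝟙-yes : ∀ {P : Set} (P? : Dec P) → P → 𝟙 P? ≡ 1ℚ
  𝟙-yes P? p rewrite dec-true P? p = refl

  𝟙-no : ∀ {P : Set} (P? : Dec P) → ¬ P → 𝟙 P? ≡ 0ℚ
  𝟙-no P? ¬p rewrite dec-false P? ¬p = refl

  𝟙-mono : ∀ {P Q : Set} (P? : Dec P) (Q? : Dec Q) → (P → Q) → 𝟙 P? ≤ 𝟙 Q?
  𝟙-mono (yes p) Q? P⇒Q = ≤-reflexive (sym (𝟙-yes Q? (P⇒Q p)))
  𝟙-mono (no  _) Q? _   = 𝟙-nonNeg Q?

  module _ {A : Set} where

    mass : Dist A → ℚ
    mass μ = 𝔼 μ (λ _ → 1ℚ)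

    OnSupport : (A → Set) → Dist A → Set
    OnSupport P μ = All (P ∘ proj₂) μ

    -- Mass ≤ 1 is all the bounds need, and it holds without checking that the lists passed to uniform are nonempty.
    record IsSubprobability (μ : Dist A) : Set where
      field
        weights-nonNeg : All ((0ℚ ≤_) ∘ proj₁) μ
        mass≤1         : mass μ ≤ 1ℚ

    ℙ≡𝔼𝟙 : (μ : Dist A) {P : Pred A 0ℓ} (P? : Decidable P) → ℙ μ P? ≡ 𝔼 μ (𝟙 ∘ P?)
    ℙ≡𝔼𝟙 [] P? = refl
    ℙ≡𝔼𝟙 ((p , a) ∷ μ) P? with does (P? a)
    ... | true  = cong₂ _+_ (sym (*-identityʳ p)) (ℙ≡𝔼𝟙 μ P?)
    ... | false = cong₂ _+_ (sym (*-zeroʳ p)) (ℙ≡𝔼𝟙 μ P?)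

    𝔼-++ : ∀ (μ ν : Dist A) f → 𝔼 (μ ++ ν) f ≡ 𝔼 μ f + 𝔼 ν f
    𝔼-++ []            ν f = sym (+-identityˡ _)
    𝔼-++ ((p , a) ∷ μ) ν f = trans (cong (p * f a +_) (𝔼-++ μ ν f)) (sym (+-assoc (p * f a) (𝔼 μ f) (𝔼 ν f)))

    𝔼-+ : ∀ (μ : Dist A) f g → 𝔼 μ (λ a → f a + g a) ≡ 𝔼 μ f + 𝔼 μ g
    𝔼-+ []            f g = refl
    𝔼-+ ((p , a) ∷ μ) f g = trans (cong (p * (f a + g a) +_) (𝔼-+ μ f g))
      (solve 5 (λ p fa ga u v → p :* (fa :+ ga) :+ (u :+ v) := (p :* fa :+ u) :+ (p :* ga :+ v)) refl p (f a) (g a) (𝔼 μ f) (𝔼 μ g))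
      where open +-*-Solver

    𝔼-*ˡ : ∀ (μ : Dist A) c f → 𝔼 μ (λ a → c * f a) ≡ c * 𝔼 μ f
    𝔼-*ˡ []            c f = sym (*-zeroʳ c)
    𝔼-*ˡ ((p , a) ∷ μ) c f = trans (cong (p * (c * f a) +_) (𝔼-*ˡ μ c f))
      (solve 4 (λ p c fa u → p :* (c :* fa) :+ c :* u := c :* (p :* fa :+ u)) refl p c (f a) (𝔼 μ f))
      where open +-*-Solver

    𝔼-cong : ∀ (μ : Dist A) {f g} → (∀ a → f a ≡ g a) → 𝔼 μ f ≡ 𝔼 μ g
    𝔼-cong []            f≗g = refl
    𝔼-cong ((p , a) ∷ μ) f≗g = cong₂ (λ u v → p * u + v) (f≗g a) (𝔼-cong μ f≗g)

    𝔼-const : ∀ (μ : Dist A) c → 𝔼 μ (λ _ → c) ≡ c * mass μ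
    𝔼-const μ c = trans (𝔼-cong μ (λ _ → sym (*-identityʳ c))) (𝔼-*ˡ μ c (λ _ → 1ℚ))

    𝔼-mono : ∀ {μ : Dist A} {f g} → All ((0ℚ ≤_) ∘ proj₁) μ →
             OnSupport (λ a → f a ≤ g a) μ → 𝔼 μ f ≤ 𝔼 μ g
    𝔼-mono {[]}          []          []          = ≤-refl
    𝔼-mono {(p , a) ∷ μ} (0≤p ∷ 0≤μ) (fa≤ga ∷ f≤g) =
      +-mono-≤ (*-monoˡ-≤-nonNeg p {{ℚ.nonNegative 0≤p}} fa≤ga) (𝔼-mono 0≤μ f≤g)

    𝔼≤const : ∀ {μ : Dist A} {f c} → IsSubprobability μ → 0ℚ ≤ c →
              OnSupport (λ a → f a ≤ c) μ → 𝔼 μ f ≤ c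
    𝔼≤const {μ} {f} {c} μ-sub 0≤c f≤c = begin
      𝔼 μ f          ≤⟨ 𝔼-mono (IsSubprobability.weights-nonNeg μ-sub) f≤c ⟩
      𝔼 μ (λ _ → c)  ≡⟨ 𝔼-const μ c ⟩
      c * mass μ     ≤⟨ *-monoˡ-≤-nonNeg c {{ℚ.nonNegative 0≤c}} (IsSubprobability.mass≤1 μ-sub) ⟩
      c * 1ℚ         ≡⟨ *-identityʳ c ⟩
      c              ∎
      where open ≤-Reasoning

    𝔼-return : ∀ (a : A) f → 𝔼 (return a) f ≡ f a
    𝔼-return a f = trans (+-identityʳ _) (*-identityˡ _)

    return-isSubprobability : (a : A) → IsSubprobability (return a)
    return-isSubprobability a = record { weights-nonNeg = 0≤1 ∷ [] ; mass≤1 = ≤-reflexive (𝔼-return a (λ _ → 1ℚ)) }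

    ℙ-scaled : ∀ w (xs : List A) {P : Pred A 0ℓ} (P? : Decidable P) →
               ℙ (List.map (λ b → (w , b)) xs) P? ≡ w * ℕ→ℚ (length (filter P? xs))
    ℙ-scaled w []       P? = sym (*-zeroʳ w)
    ℙ-scaled w (x ∷ xs) P? with does (P? x)
    ... | true  = begin
      w + ℙ (List.map (λ b → (w , b)) xs) P?       ≡⟨ cong (w +_) (ℙ-scaled w xs P?) ⟩
      w + w * ℕ→ℚ (length (filter P? xs))          ≡⟨ solve 2 (λ w c → w :+ w :* c := w :* (con 1ℚ :+ c)) refl w _ ⟩
      w * (1ℚ + ℕ→ℚ (length (filter P? xs)))       ≡⟨ cong (w *_) (sym (ℕ→ℚ-+ 1 (length (filter P? xs)))) ⟩
      w * ℕ→ℚ (suc (length (filter P? xs)))        ∎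
      where open ≡-Reasoning
            open +-*-Solver
    ... | false = trans (+-identityˡ _) (ℙ-scaled w xs P?)

    ℙ-uniform : ∀ (l : List A) {P : Pred A 0ℓ} (P? : Decidable P) →
                ℙ (uniform l) P? * ℕ→ℚ (length l) ≡ ℕ→ℚ (length (filter P? l))
    ℙ-uniform []       P? = refl
    ℙ-uniform (a ∷ as) P? = begin
      ℙ (uniform (a ∷ as)) P? * N   ≡⟨ cong (_* N) (ℙ-scaled w (a ∷ as) P?) ⟩
      w * c * N                     ≡⟨ solve 3 (λ w c N → w :* c :* N := c :* (w :* N)) refl w c N ⟩
      c * (w * N)                   ≡⟨ cong (c *_) (a/n*n≡a 1 (suc (length as))) ⟩
      c * 1ℚ                        ≡⟨ *-identityʳ c ⟩
      c                             ∎
      where open ≡-Reasoning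
            open +-*-Solver
            w = (ℤ.+ 1) / suc (length as)
            N = ℕ→ℚ (suc (length as))
            c = ℕ→ℚ (length (filter P? (a ∷ as)))

    mass-uniform : ∀ (l : List A) → mass (uniform l) * ℕ→ℚ (length l) ≡ ℕ→ℚ (length l)
    mass-uniform l = begin
      mass (uniform l) * ℕ→ℚ (length l)       ≡⟨ cong (_* ℕ→ℚ (length l)) (sym (ℙ≡𝔼𝟙 (uniform l) always)) ⟩
      ℙ (uniform l) always * ℕ→ℚ (length l)   ≡⟨ ℙ-uniform l always ⟩
      ℕ→ℚ (length (filter always l))          ≡⟨ cong (ℕ→ℚ ∘ length) (filter-all always (All.universal _ l)) ⟩
      ℕ→ℚ (length l)                          ∎
      where open ≡-Reasoning
            always : Decidable (λ (_ : A) → ⊤)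
            always _ = yes tt

    uniform-isSubprobability : (l : List A) → IsSubprobability (uniform l)
    uniform-isSubprobability l = record { weights-nonNeg = weights l ; mass≤1 = mass≤1 l }
      where
      weights : (l : List A) → All ((0ℚ ≤_) ∘ proj₁) (uniform l)
      weights []       = []
      weights (a ∷ as) = All.map⁺ (All.universal (λ _ → 0≤a/n 1 (suc (length as))) (a ∷ as))
      mass≤1 : (l : List A) → mass (uniform l) ≤ 1ℚ
      mass≤1 []       = 0≤1
      mass≤1 (a ∷ as) = *-cancelʳ-≤-pos (ℕ→ℚ (suc (length as))) {{normalize-pos (suc (length as)) 1}}
        (≤-reflexive (trans (mass-uniform (a ∷ as)) (sym (*-identityˡ _))))

    uniform-support : ∀ {P : A → Set} {l : List A} → All P l → OnSupport P (uniform l)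
    uniform-support {l = []}     []    = []
    uniform-support {l = a ∷ as} P[l]  = All.map⁺ P[l]

  module _ {A B : Set} where

    𝔼-bind : ∀ (μ : Dist A) (f : A → Dist B) g → 𝔼 (μ >>= f) g ≡ 𝔼 μ (λ a → 𝔼 (f a) g)
    𝔼-bind []            f g = refl
    𝔼-bind ((p , a) ∷ μ) f g = trans (𝔼-++ (List.map _ (f a)) (μ >>= f) g)
      (cong₂ _+_ (𝔼-scaled (f a)) (𝔼-bind μ f g))
      where
      𝔼-scaled : ∀ (ν : Dist B) → 𝔼 (List.map (λ { (q , b) → (p * q , b) }) ν) g ≡ p * 𝔼 ν g
      𝔼-scaled []            = sym (*-zeroʳ p)
      𝔼-scaled ((q , b) ∷ ν) = trans (cong₂ _+_ (*-assoc p q (g b)) (𝔼-scaled ν)) (sym (*-distribˡ-+ p (q * g b) (𝔼 ν g)))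

    𝔼->>=-≤ : ∀ {μ : Dist A} {f : A → Dist B} {g h} → All ((0ℚ ≤_) ∘ proj₁) μ →
              (∀ a → 𝔼 (f a) g ≤ h a) → 𝔼 (μ >>= f) g ≤ 𝔼 μ h
    𝔼->>=-≤ {μ} {f} {g} 0≤μ f≤h = ≤-trans (≤-reflexive (𝔼-bind μ f g)) (𝔼-mono 0≤μ (All.universal (λ (_ , a) → f≤h a) μ))

    >>=-isSubprobability : ∀ {μ : Dist A} {f : A → Dist B} → IsSubprobability μ →
                           (∀ a → IsSubprobability (f a)) → IsSubprobability (μ >>= f)
    >>=-isSubprobability {μ} {f} μ-sub f-sub = record
      { weights-nonNeg = weights μ (IsSubprobability.weights-nonNeg μ-sub)
      ; mass≤1 = subst (_≤ 1ℚ) (sym (𝔼-bind μ f (λ _ → 1ℚ)))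
          (𝔼≤const μ-sub 0≤1 (All.universal (λ (_ , a) → IsSubprobability.mass≤1 (f-sub a)) μ))
      }
      where
      weights : ∀ ν → All ((0ℚ ≤_) ∘ proj₁) ν → All ((0ℚ ≤_) ∘ proj₁) (ν >>= f)
      weights []            []          = []
      weights ((p , a) ∷ ν) (0≤p ∷ 0≤ν) =
        All.++⁺ (All.map⁺ (All.map (*-preserves-0≤ 0≤p) (IsSubprobability.weights-nonNeg (f-sub a)))) (weights ν 0≤ν)

module Tuples where

  open import Defs
  open import Function using (_∘_)
  open import Data.Nat using (zero; suc; _+_; _*_; _^_)
  open import Data.Nat.Properties using (*-identityˡ; *-distribʳ-+)
  open import Data.Fin using (Fin)
  open import Data.List as List using (List; []; _∷_; _++_; length; filter; allFin; concatMap)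
  open import Data.List.Properties using (length-++; filter-++; filter-all; filter-≐; filter-none; length-tabulate)
  open import Data.List.Relation.Unary.All as All using (All; all?; _∷_)
  open import Data.Unit using (⊤; tt)
  open import Data.Product using (_,_)
  open import Relation.Nullary using (yes; no)
  open import Relation.Unary using (Pred; Decidable)
  open import Relation.Binary.PropositionalEquality
  open import Level using (0ℓ)

  module _ {A B : Set} {P : Pred B 0ℓ} (P? : Decidable P) where

    length-filter-map : ∀ (f : A → B) xs → length (filter P? (List.map f xs)) ≡ length (filter (P? ∘ f) xs)
    length-filter-map f []       = refl
    length-filter-map f (x ∷ xs) with P? (f x)
    ... | yes _ = cong suc (length-filter-map f xs)
    ... | no  _ = length-filter-map f xs

  module _ {A : Set} {P : Pred A 0ℓ} (P? : Decidable P) where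

    length-filter-all-∷ : ∀ x (T : List (List A)) →
      length (filter (all? P?) (List.map (x ∷_) T)) ≡ length (filter P? (x ∷ [])) * length (filter (all? P?) T)
    length-filter-all-∷ x T with P? x
    ... | yes px = begin
      length (filter (all? P?) (List.map (x ∷_) T))   ≡⟨ length-filter-map (all? P?) (x ∷_) T ⟩
      length (filter (all? P? ∘ (x ∷_)) T)             ≡⟨ cong length (filter-≐ (all? P? ∘ (x ∷_)) (all? P?) (All.tail , (px ∷_)) T) ⟩
      length (filter (all? P?) T)                     ≡⟨ sym (*-identityˡ _) ⟩
      1 * length (filter (all? P?) T)                 ∎
      where open ≡-Reasoning
    ... | no ¬px = trans (length-filter-map (all? P?) (x ∷_) T)
                         (cong length (filter-none (all? P? ∘ (x ∷_)) (All.universal (λ _ → ¬px ∘ All.head) T)))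

    length-filter-all-prepend : ∀ (xs : List A) (T : List (List A)) →
      length (filter (all? P?) (concatMap (λ i → List.map (i ∷_) T) xs)) ≡ length (filter P? xs) * length (filter (all? P?) T)
    length-filter-all-prepend []       T = refl
    length-filter-all-prepend (x ∷ xs) T = begin
      length (filter (all? P?) (List.map (x ∷_) T ++ rest))                         ≡⟨ cong length (filter-++ (all? P?) (List.map (x ∷_) T) rest) ⟩
      length (filter (all? P?) (List.map (x ∷_) T) ++ filter (all? P?) rest)         ≡⟨ length-++ (filter (all? P?) (List.map (x ∷_) T)) ⟩
      length (filter (all? P?) (List.map (x ∷_) T)) + length (filter (all? P?) rest) ≡⟨ cong₂ _+_ (length-filter-all-∷ x T) (length-filter-all-prepend xs T) ⟩
      length (filter P? (x ∷ [])) * c + length (filter P? xs) * c                    ≡⟨ sym (*-distribʳ-+ c (length (filter P? (x ∷ []))) _) ⟩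
      (length (filter P? (x ∷ [])) + length (filter P? xs)) * c                      ≡⟨ cong (_* c) (sym (length-++ (filter P? (x ∷ [])))) ⟩
      length (filter P? (x ∷ []) ++ filter P? xs) * c                                ≡⟨ cong (λ l → length l * c) (sym (filter-++ P? (x ∷ []) xs)) ⟩
      length (filter P? (x ∷ xs)) * c                                               ∎
      where open ≡-Reasoning
            rest = concatMap (λ i → List.map (i ∷_) T) xs
            c = length (filter (all? P?) T)

  length-filter-all-tuples : ∀ {n} {P : Pred (Fin n) 0ℓ} (P? : Decidable P) d →
    length (filter (all? P?) (tuples n d)) ≡ length (filter P? (allFin n)) ^ d
  length-filter-all-tuples P? zero = refl
  length-filter-all-tuples {n} P? (suc d) =
    trans (length-filter-all-prepend P? (allFin n) (tuples n d)) (cong (length (filter P? (allFin n)) *_) (length-filter-all-tuples P? d))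

  length-tuples : ∀ n d → length (tuples n d) ≡ n ^ d
  length-tuples n d = begin
    length (tuples n d)                                   ≡⟨ cong length (sym (filter-all (all? always) (All.universal (λ S → All.universal _ S) (tuples n d)))) ⟩
    length (filter (all? always) (tuples n d))            ≡⟨ length-filter-all-tuples always d ⟩
    length (filter always (allFin n)) ^ d                 ≡⟨ cong (λ l → length l ^ d) (filter-all always (All.universal _ (allFin n))) ⟩
    length (allFin n) ^ d                                 ≡⟨ cong (_^ d) (length-tabulate (λ i → i)) ⟩
    n ^ d                                                 ∎
    where open ≡-Reasoning
          always : Decidable (λ (_ : Fin n) → ⊤)
          always _ = yes tt

module LeastLoaded where

  open import Defs
  open Tuples using (length-filter-map)
  open import Function using (_∘_)
  open import Data.Nat as ℕ using (ℕ; zero; suc; _+_; _≤_; _<_; _≤?_; z≤n; s≤s; _⊔_)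
  import Data.Nat.Properties as ℕ
  open import Data.Nat.ListAction using (sum)
  open import Data.Fin as Fin using (Fin)
  open import Data.Vec as Vec using (Vec)
  open import Data.List as List using (List; []; _∷_; _++_; length; take; filter; allFin)
  open import Data.List.Properties using (filter-++; length-++; filter-all; filter-none; filter-accept; map-tabulate)
  open import Data.List.Relation.Unary.All as All using (All; []; _∷_)
  open import Data.List.Relation.Unary.All.Properties using (all-filter; take⁺)
  open import Data.List.Relation.Unary.AllPairs using (AllPairs; _∷_)
  open import Data.List.Relation.Unary.Any using (here; there)
  open import Data.List.Relation.Unary.Linked using (Linked; [-]; _∷_)
  open import Data.List.Relation.Unary.Linked.Properties using (Linked⇒AllPairs)
  open import Data.List.Membership.Propositional using (_∈_)
  open import Data.List.Membership.Propositional.Properties using (∈-++⁺ʳ)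
  open import Data.List.Membership.DecPropositional ℕ._≟_ using (_∈?_)
  open import Data.List.Relation.Binary.Sublist.Propositional using (_⊆_; ⊆-refl)
  open import Data.List.Relation.Binary.Sublist.Propositional.Properties using (filter⁺; filter-⊆; length-mono-≤)
  open import Data.List.Relation.Binary.Permutation.Propositional using (_↭_; prep; ↭-sym; ↭⇒↭ₛ; module PermutationReasoning)
  open import Data.List.Relation.Binary.Permutation.Propositional.Properties using (shift; drop-mid; ∈-resp-↭; filter-↭; ↭-length; All-resp-↭)
  open import Data.List.Relation.Binary.Equality.Propositional using (≋⇒≡)
  open import Data.List.Relation.Unary.Sorted.TotalOrder.Properties using (↗↭↗⇒≋)
  open import Data.List.Sort ℕ.≤-decTotalOrder using (sort; sort-↭; sort-↗)
  open import Data.List.Extrema.Nat using (argmax; argmax-all; f[⊥]≤f[argmax]; f[xs]≤f[argmax])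
  open import Data.Product using (∃₂; _×_; _,_; proj₂)
  open import Data.Sum using (_⊎_; inj₁; inj₂)
  open import Relation.Nullary using (yes; no; contradiction)
  open import Relation.Unary using (Decidable)
  open import Relation.Binary.PropositionalEquality

  rank : List ℕ → ℕ → ℕ
  rank l a = length (filter (_≤? a) l)

  rank-mono : ∀ l {v w} → v ≤ w → rank l v ≤ rank l w
  rank-mono l v≤w = length-mono-≤ (filter⁺ (_≤? _) (_≤? _) (λ { refl u≤v → ℕ.≤-trans u≤v v≤w }) (⊆-refl {x = l}))

  length≤rank-bound : ∀ {j l G} → G ⊆ l → All (λ v → rank l v ≤ j) G → length G ≤ j
  length≤rank-bound {G = []}     _    _          = z≤n
  length≤rank-bound {j} {l} {G = g ∷ gs} G⊆l rank≤j = begin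
    length G                      ≡⟨ cong length (sym (filter-all (_≤? a) G≤a)) ⟩
    length (filter (_≤? a) G)     ≤⟨ length-mono-≤ (filter⁺ (_≤? a) (_≤? a) (λ { refl → λ v≤a → v≤a }) G⊆l) ⟩
    rank l a                      ≤⟨ argmax-all (λ v → v) (All.head rank≤j) (All.tail rank≤j) ⟩
    j                             ∎
    where
    open ℕ.≤-Reasoning
    G = g ∷ gs
    a = argmax (λ v → v) g gs
    G≤a : All (_≤ a) G
    G≤a = f[⊥]≤f[argmax] {f = λ v → v} g gs ∷ f[xs]≤f[argmax] {f = λ v → v} g gs

  rank-↭ : ∀ {l l'} a → l ↭ l' → rank l a ≡ rank l' a
  rank-↭ a l↭l' = ↭-length (filter-↭ (_≤? a) l↭l')

  rank-split : ∀ xs {a ys} → All (_≤ a) xs → All (a <_) ys → rank (xs ++ a ∷ ys) a ≡ suc (length xs)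
  rank-split xs {a} {ys} xs≤a a<ys = begin
    length (filter (_≤? a) (xs ++ a ∷ ys))                   ≡⟨ cong length (filter-++ (_≤? a) xs (a ∷ ys)) ⟩
    length (filter (_≤? a) xs ++ filter (_≤? a) (a ∷ ys))    ≡⟨ length-++ (filter (_≤? a) xs) ⟩
    length (filter (_≤? a) xs) + length (filter (_≤? a) (a ∷ ys))
      ≡⟨ cong₂ (λ u v → length u + length v) (filter-all (_≤? a) xs≤a) (filter-accept (_≤? a) ℕ.≤-refl) ⟩
    length xs + suc (length (filter (_≤? a) ys))             ≡⟨ cong (λ u → length xs + suc (length u)) (filter-none (_≤? a) (All.map ℕ.<⇒≱ a<ys)) ⟩
    length xs + 1                                           ≡⟨ ℕ.+-comm (length xs) 1 ⟩
    suc (length xs)                                         ∎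
    where open ≡-Reasoning

  -- The split is at the last occurrence of a, so that incrementing it keeps the list sorted.
  sorted-split : ∀ {zs} a → AllPairs _≤_ zs → a ∈ zs →
                 ∃₂ λ xs ys → zs ≡ xs ++ a ∷ ys × All (_≤ a) xs × All (a <_) ys
  sorted-split {z ∷ zs} a (z≤zs ∷ zs↗) a∈z∷zs with a ∈? zs
  ... | yes a∈zs with sorted-split a zs↗ a∈zs
  ...   | xs , ys , refl , xs≤a , a<ys = z ∷ xs , ys , refl , All.lookup z≤zs a∈zs ∷ xs≤a , a<ys
  sorted-split {a ∷ zs} a (a≤zs ∷ _) (here refl) | no a∉zs =
    [] , zs , refl , [] , All.tabulate (λ {y} y∈zs → ℕ.≤∧≢⇒< (All.lookup a≤zs y∈zs) (λ { refl → a∉zs y∈zs }))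
  sorted-split {z ∷ zs} a _ (there a∈zs) | no a∉zs = contradiction a∈zs a∉zs

  ↗-increment : ∀ xs {a ys} → Linked _≤_ (xs ++ a ∷ ys) → All (a <_) ys → Linked _≤_ (xs ++ suc a ∷ ys)
  ↗-increment []           {ys = []}    _            _           = [-]
  ↗-increment []           {ys = y ∷ _} (_ ∷ ↗ys)    (a<y ∷ _)   = a<y ∷ ↗ys
  ↗-increment (x ∷ [])     (x≤a ∷ ↗rest) a<ys                   = ℕ.m≤n⇒m≤1+n x≤a ∷ ↗-increment [] ↗rest a<ys
  ↗-increment (x ∷ x' ∷ xs) (x≤x' ∷ ↗rest) a<ys                 = x≤x' ∷ ↗-increment (x' ∷ xs) ↗rest a<ys

  sort-unique : ∀ {xs ys} → Linked _≤_ ys → sort xs ↭ ys → sort xs ≡ ys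
  sort-unique {xs} ys↗ sort↭ys = ≋⇒≡ (↗↭↗⇒≋ ℕ.≤-totalOrder (sort-↗ xs) ys↗ (↭⇒↭ₛ sort↭ys))

  sort-increment : ∀ pre post {a xs ys} → sort (pre ++ a ∷ post) ≡ xs ++ a ∷ ys → All (a <_) ys →
                   sort (pre ++ suc a ∷ post) ≡ xs ++ suc a ∷ ys
  sort-increment pre post {a} {xs} {ys} sort≡ a<ys =
    sort-unique (↗-increment xs (subst (Linked _≤_) sort≡ (sort-↗ (pre ++ a ∷ post))) a<ys) (begin
      sort (pre ++ suc a ∷ post)   ↭⟨ sort-↭ (pre ++ suc a ∷ post) ⟩
      pre ++ suc a ∷ post          ↭⟨ shift (suc a) pre post ⟩
      suc a ∷ pre ++ post          ↭⟨ prep (suc a) (↭-sym (drop-mid xs pre (subst (_↭ pre ++ a ∷ post) sort≡ (sort-↭ (pre ++ a ∷ post))))) ⟩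
      suc a ∷ xs ++ ys             ↭⟨ ↭-sym (shift (suc a) xs ys) ⟩
      xs ++ suc a ∷ ys             ∎)
    where open PermutationReasoning

  sum-take-increment : ∀ xs a ys j →
    sum (take j (xs ++ suc a ∷ ys)) ≡ sum (take j (xs ++ a ∷ ys)) ⊎
    (sum (take j (xs ++ suc a ∷ ys)) ≡ suc (sum (take j (xs ++ a ∷ ys))) × length xs < j)
  sum-take-increment xs       a ys zero    = inj₁ refl
  sum-take-increment []       a ys (suc j) = inj₂ (refl , s≤s z≤n)
  sum-take-increment (x ∷ xs) a ys (suc j) with sum-take-increment xs a ys j
  ... | inj₁ same         = inj₁ (cong (x +_) same)
  ... | inj₂ (grew , len<j) = inj₂ (trans (cong (x +_) grew) (ℕ.+-suc x _) , s≤s len<j)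

  smallestSum : ℕ → List ℕ → ℕ
  smallestSum j l = sum (take j (sort l))

  smallestSum-increment : ∀ j pre a post →
    smallestSum j (pre ++ suc a ∷ post) ≡ smallestSum j (pre ++ a ∷ post) ⊎
    (smallestSum j (pre ++ suc a ∷ post) ≡ suc (smallestSum j (pre ++ a ∷ post)) × rank (pre ++ a ∷ post) a ≤ j)
  smallestSum-increment j pre a post
    with sorted-split a (Linked⇒AllPairs ℕ.≤-trans (sort-↗ l)) (∈-resp-↭ (↭-sym (sort-↭ l)) (∈-++⁺ʳ pre (here refl)))
    where l = pre ++ a ∷ post
  ... | xs , ys , sort≡ , xs≤a , a<ys rewrite sort≡ | sort-increment pre post sort≡ a<ys with sum-take-increment xs a ys j
  ...   | inj₁ same         = inj₁ same
  ...   | inj₂ (grew , len<j) = inj₂ (grew , ℕ.≤-trans (ℕ.≤-reflexive rank≡) len<j)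
    where
    rank≡ : rank (pre ++ a ∷ post) a ≡ suc (length xs)
    rank≡ = trans (sym (rank-↭ a (subst (_↭ pre ++ a ∷ post) sort≡ (sort-↭ (pre ++ a ∷ post))))) (rank-split xs xs≤a a<ys)

  toList-addBall : ∀ {n} (L : Loads n) i → ∃₂ λ pre post →
    Vec.toList L ≡ pre ++ Vec.lookup L i ∷ post × Vec.toList (addBall L i) ≡ pre ++ suc (Vec.lookup L i) ∷ post
  toList-addBall (x Vec.∷ L) Fin.zero    = [] , Vec.toList L , refl , refl
  toList-addBall (x Vec.∷ L) (Fin.suc i) with toList-addBall L i
  ... | pre , post , L≡ , L'≡ = x ∷ pre , post , cong (x ∷_) L≡ , cong (x ∷_) L'≡

  toList≡tabulate-lookup : ∀ {n} (L : Loads n) → Vec.toList L ≡ List.tabulate (Vec.lookup L)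
  toList≡tabulate-lookup Vec.[]      = refl
  toList≡tabulate-lookup (x Vec.∷ L) = cong (x ∷_) (toList≡tabulate-lookup L)

  module _ {n : ℕ} (j : ℕ) where

    loadRank : Loads n → Fin n → ℕ
    loadRank L b = rank (Vec.toList L) (Vec.lookup L b)

    IsLight : Loads n → Fin n → Set
    IsLight L b = loadRank L b ≤ j

    light? : ∀ L → Decidable (IsLight L)
    light? L b = loadRank L b ≤? j

    leastLoadedSum-addBall : ∀ (L : Loads n) i →
      leastLoadedSum j (addBall L i) ≡ leastLoadedSum j L ⊎
      (leastLoadedSum j (addBall L i) ≡ suc (leastLoadedSum j L) × IsLight L i)
    leastLoadedSum-addBall L i with toList-addBall L i
    ... | pre , post , L≡ , L'≡ rewrite L≡ | L'≡ = smallestSum-increment j pre (Vec.lookup L i) post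

    length-filter-light≤j : ∀ L → length (filter (light? L) (allFin n)) ≤ j
    length-filter-light≤j L = subst (_≤ j) count≡ (length≤rank-bound (filter-⊆ low? l) (all-filter low? l))
      where
      l = Vec.toList L
      low? = λ v → rank l v ≤? j
      count≡ : length (filter low? l) ≡ length (filter (light? L) (allFin n))
      count≡ = begin
        length (filter low? l)                                    ≡⟨ cong (length ∘ filter low?) (toList≡tabulate-lookup L) ⟩
        length (filter low? (List.tabulate (Vec.lookup L)))       ≡⟨ cong (length ∘ filter low?) (sym (map-tabulate (λ b → b) (Vec.lookup L))) ⟩
        length (filter low? (List.map (Vec.lookup L) (allFin n))) ≡⟨ length-filter-map low? (Vec.lookup L) (allFin n) ⟩
        length (filter (light? L) (allFin n))                     ∎
        where open ≡-Reasoning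

  ≤-maxLoad : ∀ {n} (L : Loads n) S → All (λ b → Vec.lookup L b ≤ maxLoad L S) S
  ≤-maxLoad L []      = []
  ≤-maxLoad L (b ∷ S) = ℕ.m≤m⊔n _ _ ∷ All.map (λ b≤ → ℕ.≤-trans b≤ (ℕ.m≤n⊔m _ _)) (≤-maxLoad L S)

  maximalBins-maximal : ∀ {n} (L : Loads n) S → All (λ i → Vec.lookup L i ≡ maxLoad L S) (maximalBins L S)
  maximalBins-maximal L S = All.map proj₂ (all-filter _ (allFin _))

  maximal⇒light : ∀ {n} j (L : Loads n) S {i} → Vec.lookup L i ≡ maxLoad L S → IsLight j L i → All (IsLight j L) S
  maximal⇒light j L S i-max i-light =
    All.map (λ b≤ → ℕ.≤-trans (rank-mono (Vec.toList L) (ℕ.≤-trans b≤ (ℕ.≤-reflexive (sym i-max)))) i-light) (≤-maxLoad L S)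

  leastLoadedSum-empty : ∀ {n} j → leastLoadedSum j (Vec.replicate n 0) ≡ 0
  leastLoadedSum-empty {n} j = sum-zeros (take⁺ j (All-resp-↭ (↭-sym (sort-↭ _)) (zeros n)))
    where
    sum-zeros : ∀ {xs} → All (_≡ 0) xs → sum xs ≡ 0
    sum-zeros []          = refl
    sum-zeros (refl ∷ xs) = sum-zeros xs
    zeros : ∀ k → All (_≡ 0) (Vec.toList (Vec.replicate k 0))
    zeros zero    = []
    zeros (suc k) = refl ∷ zeros k

module Binomial where

  open import Defs
  open Rationals
  open import Data.Nat as ℕ using (ℕ; zero; suc; _∸_; _≤?_)
  import Data.Nat.Properties as ℕ
  open import Data.Nat.Combinatorics using (_C_; nCk+nC[k+1]≡[n+1]C[k+1])
  open import Data.Nat.Combinatorics.Specification using (k>n⇒nCk≡0)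
  open import Data.Rational using (ℚ; 0ℚ; 1ℚ; _+_; _*_; _-_)
  open import Data.Rational.Properties using (*-zeroˡ; *-zeroʳ)
  open import Data.Rational.Solver using (module +-*-Solver)
  open import Relation.Nullary using (yes; no)
  open import Relation.Binary.PropositionalEquality
  open +-*-Solver

  binomialPMF : ℚ → ℕ → ℕ → ℚ
  binomialPMF x t i = ℕ→ℚ (t C i) * ((1ℚ - x) ^ℚ (t ∸ i)) * (x ^ℚ i)

  binomialCDF : ℚ → ℕ → ℕ → ℚ
  binomialCDF x t k = Σ< k (binomialPMF x t)

  C-pow-shift : ∀ y t i → ℕ→ℚ (t C suc i) * (y ^ℚ (t ∸ i)) ≡ y * (ℕ→ℚ (t C suc i) * (y ^ℚ (t ∸ suc i)))
  C-pow-shift y t i with suc i ≤? t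
  ... | yes i<t rewrite ℕ.+-∸-assoc 1 i<t = solve 3 (λ c y Y → c :* (y :* Y) := y :* (c :* Y)) refl (ℕ→ℚ (t C suc i)) y (y ^ℚ (t ∸ suc i))
  ... | no  i≮t rewrite k>n⇒nCk≡0 (ℕ.≰⇒> i≮t) = trans (*-zeroˡ (y ^ℚ (t ∸ i))) (sym (trans (cong (y *_) (*-zeroˡ (y ^ℚ (t ∸ suc i)))) (*-zeroʳ y)))

  binomialPMF-pascal : ∀ x t i → binomialPMF x (suc t) (suc i) ≡ (1ℚ - x) * binomialPMF x t (suc i) + x * binomialPMF x t i
  binomialPMF-pascal x t i = begin
    ℕ→ℚ (suc t C suc i) * Y * (x * X)                 ≡⟨ cong (λ c → ℕ→ℚ c * Y * (x * X)) (sym (nCk+nC[k+1]≡[n+1]C[k+1] t i)) ⟩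
    ℕ→ℚ (t C i ℕ.+ t C suc i) * Y * (x * X)            ≡⟨ cong (λ c → c * Y * (x * X)) (ℕ→ℚ-+ (t C i) (t C suc i)) ⟩
    (ℕ→ℚ (t C i) + ℕ→ℚ (t C suc i)) * Y * (x * X)
      ≡⟨ solve 5 (λ x X Y cᵢ cᵢ₊₁ → (cᵢ :+ cᵢ₊₁) :* Y :* (x :* X) := (cᵢ₊₁ :* Y) :* (x :* X) :+ x :* (cᵢ :* Y :* X))
                 refl x X Y (ℕ→ℚ (t C i)) (ℕ→ℚ (t C suc i)) ⟩
    (ℕ→ℚ (t C suc i) * Y) * (x * X) + x * binomialPMF x t i
      ≡⟨ cong (λ u → u * (x * X) + x * binomialPMF x t i) (C-pow-shift (1ℚ - x) t i) ⟩
    (1ℚ - x) * (ℕ→ℚ (t C suc i) * ((1ℚ - x) ^ℚ (t ∸ suc i))) * (x * X) + x * binomialPMF x t i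
      ≡⟨ cong (_+ x * binomialPMF x t i) (solve 4 (λ y u x X → y :* u :* (x :* X) := y :* (u :* (x :* X))) refl (1ℚ - x) _ x X) ⟩
    (1ℚ - x) * binomialPMF x t (suc i) + x * binomialPMF x t i ∎
    where open ≡-Reasoning
          X = x ^ℚ i
          Y = (1ℚ - x) ^ℚ (t ∸ i)

  binomialCDF-pascal : ∀ x t k → binomialCDF x (suc t) (suc k) ≡ (1ℚ - x) * binomialCDF x t (suc k) + x * binomialCDF x t k
  binomialCDF-pascal x t zero =
    solve 3 (λ x y Y → con 0ℚ :+ con 1ℚ :* (y :* Y) :* con 1ℚ := y :* (con 0ℚ :+ con 1ℚ :* Y :* con 1ℚ) :+ x :* con 0ℚ) refl
      x (1ℚ - x) ((1ℚ - x) ^ℚ t)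
  binomialCDF-pascal x t (suc k) = trans (cong₂ _+_ (binomialCDF-pascal x t k) (binomialPMF-pascal x t k))
    (solve 6 (λ x y F₁ F₀ p₁ p₀ → (y :* F₁ :+ x :* F₀) :+ (y :* p₁ :+ x :* p₀) := y :* (F₁ :+ p₁) :+ x :* (F₀ :+ p₀)) refl
      x (1ℚ - x) (binomialCDF x t (suc k)) (binomialCDF x t k) (binomialPMF x t (suc k)) (binomialPMF x t k))

  binomialTailBound-pascal : ∀ x t k →
    binomialTailBound (suc t) (suc k) x ≡ (1ℚ - x) * binomialTailBound t (suc k) x + x * binomialTailBound t k x
  binomialTailBound-pascal x t k = trans (cong (1ℚ -_) (binomialCDF-pascal x t k))
    (solve 3 (λ x F₁ F₀ → con 1ℚ :- ((con 1ℚ :- x) :* F₁ :+ x :* F₀) := (con 1ℚ :- x) :* (con 1ℚ :- F₁) :+ x :* (con 1ℚ :- F₀)) refl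
      x (binomialCDF x t (suc k)) (binomialCDF x t k))

  binomialCDF-zero-trials : ∀ x k → binomialCDF x 0 (suc k) ≡ 1ℚ
  binomialCDF-zero-trials x zero    = refl
  binomialCDF-zero-trials x (suc k) = trans (cong (_+ binomialPMF x 0 (suc k)) (binomialCDF-zero-trials x k))
    (solve 1 (λ X → con 1ℚ :+ con 0ℚ :* con 1ℚ :* X := con 1ℚ) refl (x ^ℚ suc k))

module Greedy where

  open import Defs
  open Rationals
  open Distributions
  open Tuples
  open LeastLoaded
  open Binomial
  open import Function using (_∘_)
  open import Data.Nat as ℕ using (ℕ; zero; suc; _^_; _≤?_; z≤n)
  import Data.Nat.Properties as ℕ
  import Data.Integer as ℤ
  open import Data.Rational as ℚ using (ℚ; 0ℚ; 1ℚ; _+_; _*_; _-_; _/_; _≤_)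
  open import Data.Rational.Properties hiding (_≤?_)
  open import Data.Rational.Solver using (module +-*-Solver)
  open import Data.Fin using (Fin)
  open import Data.Vec as Vec using (Vec)
  open import Data.List using (List; length; filter; allFin)
  open import Data.List.Relation.Unary.All as All using (All; all?)
  open import Data.Product using (_×_; _,_)
  open import Data.Sum using (_⊎_; inj₁; inj₂)
  open import Relation.Nullary using (Dec)
  open import Relation.Binary.PropositionalEquality

  module _ (n d j : ℕ) .{{_ : ℕ.NonZero n}} where

    x : ℚ
    x = (ℤ.+ j) / n

    allLight? : (L : Loads n) (S : List (Fin n)) → Dec (All (IsLight j L) S)
    allLight? L = all? (light? j L)

    ℙ-allLight : ∀ L → ℙ (uniform (tuples n d)) (allLight? L) ≤ x ^ℚ d
    ℙ-allLight L = *-cancelʳ-≤-pos (ℕ→ℚ (n ^ d)) {{normalize-pos (n ^ d) 1 {{_}} {{ℕ.m^n≢0 n d}}}} (begin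
      ℙ (uniform (tuples n d)) (allLight? L) * ℕ→ℚ (n ^ d)
        ≡⟨ cong (λ N → ℙ (uniform (tuples n d)) (allLight? L) * ℕ→ℚ N) (sym (length-tuples n d)) ⟩
      ℙ (uniform (tuples n d)) (allLight? L) * ℕ→ℚ (length (tuples n d))
        ≡⟨ ℙ-uniform (tuples n d) (allLight? L) ⟩
      ℕ→ℚ (length (filter (allLight? L) (tuples n d)))
        ≡⟨ cong ℕ→ℚ (length-filter-all-tuples (light? j L) d) ⟩
      ℕ→ℚ (length (filter (light? j L) (allFin n)) ^ d)
        ≤⟨ ℕ→ℚ-mono-≤ (ℕ.^-monoˡ-≤ d (length-filter-light≤j j L)) ⟩
      ℕ→ℚ (j ^ d)
        ≡⟨ sym ([a/n]^k*n^k≡a^k j n d) ⟩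
      x ^ℚ d * ℕ→ℚ (n ^ d) ∎)
      where open ≤-Reasoning

    step-isSubprobability : ∀ L → IsSubprobability (step n d L)
    step-isSubprobability L = >>=-isSubprobability (uniform-isSubprobability (tuples n d))
      (λ S → >>=-isSubprobability (uniform-isSubprobability (maximalBins L S)) (return-isSubprobability ∘ addBall L))

    greedy-isSubprobability : ∀ t → IsSubprobability (greedy t n d)
    greedy-isSubprobability zero    = return-isSubprobability (Vec.replicate n 0)
    greedy-isSubprobability (suc t) = >>=-isSubprobability (greedy-isSubprobability t) step-isSubprobability

    𝔼-step-≤ : ∀ L (h : Loads n → ℚ) {c e} → 0ℚ ≤ c → 0ℚ ≤ e →
               (∀ S i → Vec.lookup L i ≡ maxLoad L S → h (addBall L i) ≤ c + e * 𝟙 (allLight? L S)) →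
               𝔼 (step n d L) h ≤ c + e * x ^ℚ d
    𝔼-step-≤ L h {c} {e} 0≤c 0≤e h≤ = begin
      𝔼 (step n d L) h
        ≤⟨ 𝔼->>=-≤ (IsSubprobability.weights-nonNeg (uniform-isSubprobability (tuples n d))) after-step≤ ⟩
      𝔼 T (λ S → c + e * 𝟙 (allLight? L S))
        ≡⟨ trans (𝔼-+ T _ _) (cong (λ u → 𝔼 T (λ _ → c) + u) (𝔼-*ˡ T e _)) ⟩
      𝔼 T (λ _ → c) + e * 𝔼 T (𝟙 ∘ allLight? L)
        ≤⟨ +-mono-≤ (𝔼≤const (uniform-isSubprobability (tuples n d)) 0≤c (All.universal (λ _ → ≤-refl) T))
                    (*-monoˡ-≤-nonNeg e {{ℚ.nonNegative 0≤e}} (≤-trans (≤-reflexive (sym (ℙ≡𝔼𝟙 T (allLight? L)))) (ℙ-allLight L))) ⟩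
      c + e * x ^ℚ d ∎
      where
      open ≤-Reasoning
      T = uniform (tuples n d)
      after-step≤ : ∀ S → 𝔼 (uniform (maximalBins L S) >>= (return ∘ addBall L)) h ≤ c + e * 𝟙 (allLight? L S)
      after-step≤ S = ≤-trans (≤-reflexive (𝔼-bind (uniform (maximalBins L S)) (return ∘ addBall L) h)) (𝔼≤const
          (uniform-isSubprobability (maximalBins L S))
          (+-mono-≤ 0≤c (*-preserves-0≤ 0≤e (𝟙-nonNeg (allLight? L S))))
          (uniform-support (All.map (λ {i} i-max → ≤-trans (≤-reflexive (𝔼-return (addBall L i) h)) (h≤ S i i-max)) (maximalBins-maximal L S))))

    0≤x : 0ℚ ≤ x
    0≤x = 0≤a/n j n

    x≤1 : j ℕ.≤ n → x ≤ 1ℚ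
    x≤1 j≤n = *-cancelʳ-≤-pos (ℕ→ℚ n) {{normalize-pos n 1}}
      (≤-trans (≤-reflexive (a/n*n≡a j n)) (≤-trans (ℕ→ℚ-mono-≤ j≤n) (≤-reflexive (sym (*-identityˡ (ℕ→ℚ n))))))

    leastLoadedSum-step : ∀ L S i → Vec.lookup L i ≡ maxLoad L S →
      (leastLoadedSum j (addBall L i) ≡ leastLoadedSum j L) ⊎
      (leastLoadedSum j (addBall L i) ≡ suc (leastLoadedSum j L) × 𝟙 (allLight? L S) ≡ 1ℚ)
    leastLoadedSum-step L S i i-max with leastLoadedSum-addBall j L i
    ... | inj₁ same            = inj₁ same
    ... | inj₂ (grew , i-light) = inj₂ (grew , 𝟙-yes (allLight? L S) (maximal⇒light j L S i-max i-light))

    𝔼-step-leastLoadedSum : ∀ L → 𝔼 (step n d L) (ℕ→ℚ ∘ leastLoadedSum j) ≤ ℕ→ℚ (leastLoadedSum j L) + x ^ℚ d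
    𝔼-step-leastLoadedSum L = ≤-trans (𝔼-step-≤ L (ℕ→ℚ ∘ leastLoadedSum j) (ℕ→ℚ-mono-≤ {b = leastLoadedSum j L} z≤n) 0≤1 after-step)
      (≤-reflexive (cong (λ u → ℕ→ℚ (leastLoadedSum j L) + u) (*-identityˡ (x ^ℚ d))))
      where
      after-step : ∀ S i → Vec.lookup L i ≡ maxLoad L S →
                   ℕ→ℚ (leastLoadedSum j (addBall L i)) ≤ ℕ→ℚ (leastLoadedSum j L) + 1ℚ * 𝟙 (allLight? L S)
      after-step S i i-max with leastLoadedSum-step L S i i-max
      ... | inj₁ same = begin
        ℕ→ℚ (leastLoadedSum j (addBall L i))                ≡⟨ cong ℕ→ℚ same ⟩
        ℕ→ℚ (leastLoadedSum j L)                            ≡⟨ sym (+-identityʳ _) ⟩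
        ℕ→ℚ (leastLoadedSum j L) + 0ℚ                       ≤⟨ +-monoʳ-≤ (ℕ→ℚ (leastLoadedSum j L)) (*-preserves-0≤ 0≤1 (𝟙-nonNeg (allLight? L S))) ⟩
        ℕ→ℚ (leastLoadedSum j L) + 1ℚ * 𝟙 (allLight? L S)   ∎
        where open ≤-Reasoning
      ... | inj₂ (grew , all-light) = ≤-reflexive (begin-equality
        ℕ→ℚ (leastLoadedSum j (addBall L i))                ≡⟨ cong ℕ→ℚ (trans grew (ℕ.+-comm 1 _)) ⟩
        ℕ→ℚ (leastLoadedSum j L ℕ.+ 1)                      ≡⟨ ℕ→ℚ-+ (leastLoadedSum j L) 1 ⟩
        ℕ→ℚ (leastLoadedSum j L) + 1ℚ                       ≡⟨ cong (λ u → ℕ→ℚ (leastLoadedSum j L) + 1ℚ * u) (sym all-light) ⟩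
        ℕ→ℚ (leastLoadedSum j L) + 1ℚ * 𝟙 (allLight? L S)   ∎)
        where open ≤-Reasoning

    𝔼-greedy-leastLoadedSum : ∀ t → 𝔼 (greedy t n d) (ℕ→ℚ ∘ leastLoadedSum j) ≤ x ^ℚ d * ℕ→ℚ t
    𝔼-greedy-leastLoadedSum zero = ≤-reflexive (begin-equality
      𝔼 (return (Vec.replicate n 0)) (ℕ→ℚ ∘ leastLoadedSum j)  ≡⟨ 𝔼-return (Vec.replicate n 0) (ℕ→ℚ ∘ leastLoadedSum j) ⟩
      ℕ→ℚ (leastLoadedSum j (Vec.replicate n 0))             ≡⟨ cong ℕ→ℚ (leastLoadedSum-empty j) ⟩
      0ℚ                                                    ≡⟨ sym (*-zeroʳ (x ^ℚ d)) ⟩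
      x ^ℚ d * 0ℚ                                           ∎)
      where open ≤-Reasoning
    𝔼-greedy-leastLoadedSum (suc t) = begin
      𝔼 (greedy (suc t) n d) s                                  ≤⟨ 𝔼->>=-≤ (IsSubprobability.weights-nonNeg μ-sub) 𝔼-step-leastLoadedSum ⟩
      𝔼 μ (λ L → s L + x ^ℚ d)                                  ≡⟨ 𝔼-+ μ s (λ _ → x ^ℚ d) ⟩
      𝔼 μ s + 𝔼 μ (λ _ → x ^ℚ d)                                ≤⟨ +-mono-≤ (𝔼-greedy-leastLoadedSum t)
                                                                    (𝔼≤const μ-sub (^ℚ-nonNeg 0≤x d) (All.universal (λ _ → ≤-refl) μ)) ⟩
      x ^ℚ d * ℕ→ℚ t + x ^ℚ d                                   ≡⟨ solve 2 (λ q T → q :* T :+ q := q :* (T :+ con 1ℚ)) refl (x ^ℚ d) (ℕ→ℚ t) ⟩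
      x ^ℚ d * (ℕ→ℚ t + 1ℚ)                                     ≡⟨ cong (x ^ℚ d *_) (sym (trans (cong ℕ→ℚ (ℕ.+-comm 1 t)) (ℕ→ℚ-+ t 1))) ⟩
      x ^ℚ d * ℕ→ℚ (suc t)                                      ∎
      where
      open ≤-Reasoning
      open +-*-Solver
      s = ℕ→ℚ ∘ leastLoadedSum j
      μ = greedy t n d
      μ-sub = greedy-isSubprobability t

    atLeast : ℕ → Loads n → ℚ
    atLeast k L = 𝟙 (k ≤? leastLoadedSum j L)

    -- c = 𝟙[s ≥ k+1] and e = 𝟙[s ≥ k] - c in 𝔼-step-≤: s can reach k+1 in one step only from k, and then only if all of S is light.
    𝔼-step-atLeast : j ℕ.≤ n → 1 ℕ.≤ d → ∀ L k →
                     𝔼 (step n d L) (atLeast (suc k)) ≤ (1ℚ - x) * atLeast (suc k) L + x * atLeast k L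
    𝔼-step-atLeast j≤n 1≤d L k = begin
      𝔼 (step n d L) (atLeast (suc k))    ≤⟨ 𝔼-step-≤ L (atLeast (suc k)) (𝟙-nonNeg (suc k ≤? leastLoadedSum j L)) 0≤e after-step ⟩
      c + e * x ^ℚ d                      ≤⟨ +-monoʳ-≤ c (*-monoˡ-≤-nonNeg e {{ℚ.nonNegative 0≤e}} (^ℚ≤base 0≤x (x≤1 j≤n) 1≤d)) ⟩
      c + e * x                           ≡⟨ solve 3 (λ x c I → c :+ (I :- c) :* x := (con 1ℚ :- x) :* c :+ x :* I) refl x c (atLeast k L) ⟩
      (1ℚ - x) * c + x * atLeast k L      ∎
      where
      open ≤-Reasoning
      open +-*-Solver
      c = atLeast (suc k) L
      e = atLeast k L - c
      0≤e : 0ℚ ≤ e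
      0≤e = p≤q⇒0≤q-p (𝟙-mono (suc k ≤? leastLoadedSum j L) (k ≤? leastLoadedSum j L) ℕ.<⇒≤)
      after-step : ∀ S i → Vec.lookup L i ≡ maxLoad L S → atLeast (suc k) (addBall L i) ≤ c + e * 𝟙 (allLight? L S)
      after-step S i i-max with leastLoadedSum-step L S i i-max
      ... | inj₁ same rewrite same = begin
        c                          ≡⟨ sym (+-identityʳ c) ⟩
        c + 0ℚ                     ≤⟨ +-monoʳ-≤ c (*-preserves-0≤ 0≤e (𝟙-nonNeg (allLight? L S))) ⟩
        c + e * 𝟙 (allLight? L S)  ∎
      ... | inj₂ (grew , all-light) rewrite grew | all-light = begin
        𝟙 (suc k ≤? suc (leastLoadedSum j L))  ≤⟨ 𝟙-mono (suc k ≤? suc (leastLoadedSum j L)) (k ≤? leastLoadedSum j L) ℕ.≤-pred ⟩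
        atLeast k L                            ≡⟨ solve 2 (λ c I → I := c :+ (I :- c) :* con 1ℚ) refl c (atLeast k L) ⟩
        c + e * 1ℚ                             ∎

    𝔼-greedy-atLeast : j ℕ.≤ n → 1 ℕ.≤ d → ∀ t k → 𝔼 (greedy t n d) (atLeast k) ≤ binomialTailBound t k x
    𝔼-greedy-atLeast j≤n 1≤d t zero =
      𝔼≤const (greedy-isSubprobability t) 0≤1 (All.universal (λ (_ , L) → 𝟙≤1 (0 ≤? leastLoadedSum j L)) (greedy t n d))
    𝔼-greedy-atLeast j≤n 1≤d zero (suc k) = ≤-reflexive (begin-equality
      𝔼 (return (Vec.replicate n 0)) (atLeast (suc k))  ≡⟨ 𝔼-return (Vec.replicate n 0) (atLeast (suc k)) ⟩
      atLeast (suc k) (Vec.replicate n 0)              ≡⟨ 𝟙-no (suc k ≤? leastLoadedSum j (Vec.replicate n 0))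
                                                               (λ k<s → ℕ.<⇒≱ (subst (suc k ℕ.≤_) (leastLoadedSum-empty j) k<s) z≤n) ⟩
      0ℚ                                              ≡⟨ sym (cong (1ℚ -_) (binomialCDF-zero-trials x k)) ⟩
      binomialTailBound zero (suc k) x                ∎)
      where open ≤-Reasoning
    𝔼-greedy-atLeast j≤n 1≤d (suc t) (suc k) = begin
      𝔼 (greedy (suc t) n d) (atLeast (suc k))
        ≤⟨ 𝔼->>=-≤ (IsSubprobability.weights-nonNeg (greedy-isSubprobability t)) (λ L → 𝔼-step-atLeast j≤n 1≤d L k) ⟩
      𝔼 μ (λ L → (1ℚ - x) * atLeast (suc k) L + x * atLeast k L)
        ≡⟨ trans (𝔼-+ μ _ _) (cong₂ _+_ (𝔼-*ˡ μ (1ℚ - x) (atLeast (suc k))) (𝔼-*ˡ μ x (atLeast k))) ⟩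
      (1ℚ - x) * 𝔼 μ (atLeast (suc k)) + x * 𝔼 μ (atLeast k)
        ≤⟨ +-mono-≤ (*-monoˡ-≤-nonNeg (1ℚ - x) {{ℚ.nonNegative (p≤q⇒0≤q-p (x≤1 j≤n))}} (𝔼-greedy-atLeast j≤n 1≤d t (suc k)))
                    (*-monoˡ-≤-nonNeg x {{ℚ.nonNegative 0≤x}} (𝔼-greedy-atLeast j≤n 1≤d t k)) ⟩
      (1ℚ - x) * binomialTailBound t (suc k) x + x * binomialTailBound t k x
        ≡⟨ binomialTailBound-pascal x t k ⟨
      binomialTailBound (suc t) (suc k) x ∎
      where
      open ≤-Reasoning
      μ = greedy t n d

open import Defs
open import Data.Nat using (ℕ; _≤_; _≥_; NonZero)
open import Data.Nat.Properties using (_≤?_)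
open import Data.Integer using (+_)
open import Data.Rational using (ℚ; _/_) renaming (_≤_ to _≤ℚ_)
open import Data.Product using (_×_; _,_)
open import Relation.Binary.PropositionalEquality using (subst; sym)
open Distributions using (ℙ≡𝔼𝟙)
open Greedy

theorem4p1 : (m n d j : ℕ) → .{{_ : NonZero n}} → 1 ≤ m → 1 ≤ d → 1 ≤ j → j ≤ n →
    let x = (+ j) / n in
    (𝔼 (greedy m n d) (λ L → ℕ→ℚ (leastLoadedSum j L)) ≤ℚ (x ^ℚ d) Data.Rational.* ℕ→ℚ m)
    × ((k : ℕ) → 1 ≤ k →
        ℙ (greedy m n d) (λ L → k ≤? leastLoadedSum j L) ≤ℚ binomialTailBound m k x)
theorem4p1 m n d j _ 1≤d _ j≤n =
  𝔼-greedy-leastLoadedSum n d j m ,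
  λ k _ → subst (_≤ℚ binomialTailBound m k (x n d j)) (sym (ℙ≡𝔼𝟙 (greedy m n d) (λ L → k ≤? leastLoadedSum j L)))
                (𝔼-greedy-atLeast n d j j≤n 1≤d m k)
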